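{- Let $n_1,n_2,q\ge 2$ be integers and $n=n_1+n_2-1$. Then $$S_2(q,n)\ge \big(\chi(q,n_1)-1\big)\,N_2(q,n_2)/2.$$
   Context: An ordered graph is a graph on a linearly ordered vertex set. A monotone path of length $m$ in an ordered graph is a sequence of vertices $v_1<\dots<v_m$ with $v_iv_{i+1}$ an edge for all $i$. An ordered graph is $(q,m)$-path Ramsey if every coloring of its edges with $q$ colors contains a monochromatic monotone path of length $m$. $S_2(q,m)$ is the minimum number of edges of a $(q,m)$-path Ramsey ordered graph; $\chi(q,m)$ is the minimum chromatic number of a $(q,m)$-path Ramsey ordered graph; $N_2(q,m)$ is the smallest $N$ such that the complete graph on $[N]$ (with the natural order) is $(q,m)$-path Ramsey. -}

module Defs where

open import Data.Nat using (ℕ; _≤_; _+_; _<ᵇ_)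
open import Data.Fin using (Fin; toℕ; _<_)
open import Data.Bool using (Bool; true; false; _∧_; if_then_else_)
open import Data.List using (List; map)
open import Data.Nat.ListAction using (sum)
open import Data.List using () renaming (allFin to allFinL)
open import Data.Product using (Σ; _×_)
open import Relation.Binary.PropositionalEquality using (_≡_; _≢_)

-- An ordered graph on the vertex set [N] = Fin N with its natural order.
-- adj i j = true for i < j means that ij is an edge (entries with i ≥ j are ignored).
record OrderedGraph : Set where
  constructor mkOG
  field
    N   : ℕ
    adj : Fin N → Fin N → Bool
open OrderedGraph public

IsEdge : (G : OrderedGraph) → Fin (N G) → Fin (N G) → Set
IsEdge G i j = (i < j) × (adj G i j ≡ true)

isEdgeᵇ : (G : OrderedGraph) → Fin (N G) → Fin (N G) → Bool
isEdgeᵇ G i j = (toℕ i <ᵇ toℕ j) ∧ adj G i j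

edgeCount : OrderedGraph → ℕ
edgeCount G = sum (map (λ i → sum (map (λ j → if isEdgeᵇ G i j then 1 else 0)
                                        (allFinL (N G))))
                       (allFinL (N G)))

EdgeColoring : ℕ → OrderedGraph → Set
EdgeColoring q G = (i j : Fin (N G)) → IsEdge G i j → Fin q

MonoPath : (q m : ℕ) (G : OrderedGraph) → EdgeColoring q G → Set
MonoPath q m G col =
  Σ (Fin m → Fin (N G)) λ v →
  Σ (Fin q) λ c →
    ((k : Fin m) (k' : Fin m) → toℕ k' ≡ toℕ k + 1 →
       Σ (IsEdge G (v k) (v k')) λ e → col (v k) (v k') e ≡ c)

PathRamsey : (q m : ℕ) → OrderedGraph → Set
PathRamsey q m G = (col : EdgeColoring q G) → MonoPath q m G col

IsLeast : (ℕ → Set) → ℕ → Set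
IsLeast P n = P n × ((m : ℕ) → P m → n ≤ m)

Colorable : OrderedGraph → ℕ → Set
Colorable G k = Σ (Fin (N G) → Fin k) λ f →
  (i j : Fin (N G)) → IsEdge G i j → f i ≢ f j

ChromaticNumber : OrderedGraph → ℕ → Set
ChromaticNumber G k = IsLeast (Colorable G) k

K : ℕ → OrderedGraph
K M = mkOG M (λ _ _ → true)

IsS₂ : ℕ → ℕ → ℕ → Set
IsS₂ q m = IsLeast (λ e → Σ OrderedGraph λ G → PathRamsey q m G × (edgeCount G ≡ e))

Isχ : ℕ → ℕ → ℕ → Set
Isχ q m = IsLeast (λ k → Σ OrderedGraph λ G → PathRamsey q m G × ChromaticNumber G k)

IsN₂ : ℕ → ℕ → ℕ → Set
IsN₂ q m = IsLeast (λ M → PathRamsey q m (K M))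

module Submission where

-- For n₁, n₂, q ≥ 2 and n = n₁ + n₂ - 1 we prove (χ(q,n₁) - 1)·N₂(q,n₂) ≤ S₂(q,n),
-- which is stronger than the stated bound with 2·S₂(q,n) on the right.
--
-- Let G be (q,n)-path Ramsey and S a vertex set whose complement has fewer
-- than N₂(q,n₂) vertices.  If every vertex of G[S] had fewer than χ(q,n₁) - 1
-- left neighbours, the greedy colouring would give χ(G[S]) < χ(q,n₁), so G[S]
-- and the complete graph on the complement would both have colourings without
-- long monochromatic monotone paths.  Gluing them (edges leaving S get colour
-- 1, edges entering S colour 0) colours G without a monochromatic monotone
-- path on n vertices: a colour-0 path never leaves S, any other never enters
-- it.  So G[S] has a vertex of left degree ≥ χ(q,n₁) - 1; deleting such
-- vertices N₂(q,n₂) times destroys (χ(q,n₁) - 1)·N₂(q,n₂) edges.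

open import Defs
open import Data.Nat using (ℕ; zero; suc; _≤_; _<_; _+_; _*_; _∸_; _<ᵇ_; z≤n; s≤s; z<s; _≟_; _<?_; _≤?_)
open import Data.Nat.Properties
open import Data.Nat.ListAction using () renaming (sum to listSum)
open import Data.Fin as Fin using (Fin; toℕ; fromℕ<) renaming (zero to fzero; suc to fsuc)
import Data.Fin.Properties as FinP
open import Data.Fin.Properties using (pigeonhole)
open import Data.Fin.Induction using (<-weakInduction-startingFrom)
open import Data.Bool using (Bool; true; false; _∧_; not; if_then_else_)
import Data.Bool.Properties as BoolP
open import Data.Bool.Properties using (T-≡; ∧-zeroʳ; ¬-not)
open import Data.List using (map; tabulate) renaming (allFin to allFinL)
open import Data.List.Properties using (map-tabulate)
open import Data.Product using (Σ; _×_; _,_; proj₁; proj₂; map₂)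
open import Function using (_∘_)
open import Relation.Binary.PropositionalEquality
open import Relation.Nullary using (¬_; Dec; yes; no; contradiction)
open import Relation.Nullary.Decidable using (_×-dec_; _→-dec_; ¬?; map′)
open import Axiom.UniquenessOfIdentityProofs using (module Decidable⇒UIP)
open import Relation.Binary using (tri<; tri≈; tri>)
open import Function.Bundles using (Equivalence)
open import Algebra.Properties.CommutativeMonoid.Sum +-0-commutativeMonoid
  using (sum; sum-remove; sum-cong-≗; sum-replicate-zero; ∑-comm)
open import Data.Vec.Functional using (updateAt; _∷_)
open import Data.Vec.Functional.Properties using (updateAt-updates; updateAt-minimal)
open import Data.Sum using (_⊎_; inj₁; inj₂) renaming (map to ⊎-map; swap to ⊎-swap)

ind : Bool → ℕ
ind b = if b then 1 else 0

count : ∀ {n} → (Fin n → Bool) → ℕ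
count B = sum (λ i → ind (B i))

listSum-tabulate : ∀ n (f : Fin n → ℕ) → listSum (tabulate f) ≡ sum f
listSum-tabulate zero    f = refl
listSum-tabulate (suc n) f = cong (f fzero +_) (listSum-tabulate n (f ∘ fsuc))

listSum-allFin : ∀ n (f : Fin n → ℕ) → listSum (map f (allFinL n)) ≡ sum f
listSum-allFin n f = trans (cong listSum (map-tabulate (λ i → i) f)) (listSum-tabulate n f)

∑-mono-≤ : ∀ {n} {f g : Fin n → ℕ} → (∀ x → f x ≤ g x) → sum f ≤ sum g
∑-mono-≤ {zero}  f≤g = z≤n
∑-mono-≤ {suc n} f≤g = +-mono-≤ (f≤g fzero) (∑-mono-≤ (f≤g ∘ fsuc))

∑-exchange : ∀ {n} {f g : Fin n → ℕ} (v : Fin n) → (∀ x → x ≢ v → f x ≤ g x) →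
             sum f + g v ≤ sum g + f v
∑-exchange {suc n} {f} {g} v f≤g = begin
  sum f + g v                    ≡⟨ cong (_+ g v) (sum-remove {i = v} f) ⟩
  f v + rest f + g v             ≡⟨ swap-ends (f v) (rest f) (g v) ⟩
  g v + rest f + f v             ≤⟨ +-monoˡ-≤ (f v) (+-monoʳ-≤ (g v) rest-f≤rest-g) ⟩
  g v + rest g + f v             ≡⟨ cong (_+ f v) (sum-remove {i = v} g) ⟨
  sum g + f v                    ∎
  where
  open ≤-Reasoning
  rest : (Fin (suc n) → ℕ) → ℕ
  rest h = sum (λ x → h (Fin.punchIn v x))
  rest-f≤rest-g : rest f ≤ rest g
  rest-f≤rest-g = ∑-mono-≤ (λ x → f≤g (Fin.punchIn v x) (FinP.punchInᵢ≢i v x))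
  swap-ends : ∀ a b c → a + b + c ≡ c + b + a
  swap-ends a b c = trans (+-comm (a + b) c) (trans (cong (c +_) (+-comm a b)) (sym (+-assoc c b a)))

∑-strictMono : ∀ {n} {f g : Fin n → ℕ} (v : Fin n) → (∀ x → f x ≤ g x) → f v < g v → sum f < sum g
∑-strictMono {f = f} {g} v f≤g fv<gv = +-cancelʳ-< (g v) (sum f) (sum g) (begin-strict
  sum f + g v   ≤⟨ ∑-exchange v (λ x _ → f≤g x) ⟩
  sum g + f v   <⟨ +-monoʳ-< (sum g) fv<gv ⟩
  sum g + g v   ∎)
  where open ≤-Reasoning

ind-mono : ∀ {a b} → (a ≡ true → b ≡ true) → ind a ≤ ind b
ind-mono {true}  a⇒b rewrite a⇒b refl = ≤-refl
ind-mono {false} a⇒b = z≤n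

ind≤1 : ∀ b → ind b ≤ 1
ind≤1 true  = ≤-refl
ind≤1 false = z≤n

∧-mono : ∀ {a a' b b'} → (a ≡ true → a' ≡ true) → (b ≡ true → b' ≡ true) → a ∧ b ≡ true → a' ∧ b' ≡ true
∧-mono {true} {b = true} a⇒a' b⇒b' _ rewrite a⇒a' refl | b⇒b' refl = refl

∧-elimʳ : ∀ a {b} → a ∧ b ≡ true → b ≡ true
∧-elimʳ true  ab = ab

<ᵇ-irrefl : ∀ m → (m <ᵇ m) ≡ false
<ᵇ-irrefl zero    = refl
<ᵇ-irrefl (suc m) = <ᵇ-irrefl m

<⇒<ᵇ≡true : ∀ {m n} → m < n → (m <ᵇ n) ≡ true
<⇒<ᵇ≡true m<n = Equivalence.to T-≡ (<⇒<ᵇ m<n)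

<ᵇ≡true⇒< : ∀ {m n} → (m <ᵇ n) ≡ true → m < n
<ᵇ≡true⇒< {m} {n} eq = <ᵇ⇒< m n (Equivalence.from T-≡ eq)

rank : ∀ {n} → (Fin n → Bool) → Fin n → ℕ
rank B i = count (λ j → (toℕ j <ᵇ toℕ i) ∧ B j)

rank<count : ∀ {n} (B : Fin n → Bool) {i} → B i ≡ true → rank B i < count B
rank<count B {i} Bi = ∑-strictMono i (λ x → ind-mono (∧-elimʳ _)) at-i
  where
  at-i : ind ((toℕ i <ᵇ toℕ i) ∧ B i) < ind (B i)
  at-i rewrite <ᵇ-irrefl (toℕ i) | Bi = s≤s z≤n

rank-strictMono : ∀ {n} (B : Fin n → Bool) {i j} → B i ≡ true → toℕ i < toℕ j → rank B i < rank B j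
rank-strictMono B {i} {j} Bi i<j = ∑-strictMono i below-i⇒below-j at-i
  where
  below-i⇒below-j : ∀ x → ind ((toℕ x <ᵇ toℕ i) ∧ B x) ≤ ind ((toℕ x <ᵇ toℕ j) ∧ B x)
  below-i⇒below-j x = ind-mono (∧-mono (λ x<i → <⇒<ᵇ≡true (<-trans (<ᵇ≡true⇒< x<i) i<j)) (λ Bx → Bx))
  at-i : ind ((toℕ i <ᵇ toℕ i) ∧ B i) < ind ((toℕ i <ᵇ toℕ j) ∧ B i)
  at-i rewrite <ᵇ-irrefl (toℕ i) | <⇒<ᵇ≡true i<j | Bi = s≤s z≤n

rank-injective : ∀ {n} (B : Fin n → Bool) {i j} → B i ≡ true → B j ≡ true → rank B i ≡ rank B j → i ≡ j
rank-injective B {i} {j} Bi Bj eq with <-cmp (toℕ i) (toℕ j)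
... | tri< i<j _ _ = contradiction eq (<⇒≢ (rank-strictMono B Bi i<j))
... | tri≈ _ i≡j _ = FinP.toℕ-injective i≡j
... | tri> _ _ j<i = contradiction (sym eq) (<⇒≢ (rank-strictMono B Bj j<i))

embed : ∀ {n} (B : Fin n → Bool) (i : Fin n) → B i ≡ true → Fin (count B)
embed B i Bi = fromℕ< (rank<count B Bi)

toℕ-embed : ∀ {n} (B : Fin n → Bool) {i} (Bi : B i ≡ true) → toℕ (embed B i Bi) ≡ rank B i
toℕ-embed B Bi = FinP.toℕ-fromℕ< (rank<count B Bi)

embed-strictMono : ∀ {n} (B : Fin n → Bool) {i j} (Bi : B i ≡ true) (Bj : B j ≡ true) →
                   toℕ i < toℕ j → embed B i Bi Fin.< embed B j Bj
embed-strictMono B Bi Bj i<j =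
  subst₂ _<_ (sym (toℕ-embed B Bi)) (sym (toℕ-embed B Bj)) (rank-strictMono B Bi i<j)

embed-injective : ∀ {n} (B : Fin n → Bool) {i j} (Bi : B i ≡ true) (Bj : B j ≡ true) →
                  embed B i Bi ≡ embed B j Bj → i ≡ j
embed-injective B Bi Bj eq =
  rank-injective B Bi Bj (trans (sym (toℕ-embed B Bi)) (trans (cong toℕ eq) (toℕ-embed B Bj)))

freeColour : ∀ {n d} (B : Fin n → Bool) → count B ≤ d → (f : Fin n → Fin (suc d)) →
             Σ (Fin (suc d)) λ a → ∀ i → B i ≡ true → f i ≢ a
freeColour {d = d} B small f with FinP.any? (λ a → FinP.all? (λ i → (B i BoolP.≟ true) →-dec ¬? (f i FinP.≟ a)))
... | yes free = free
... | no none  = contradiction (pigeonhole (s≤s small) index) no-collision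
  where
  preimage : ∀ a → Σ (Fin _) λ i → B i ≡ true × f i ≡ a
  preimage a with FinP.any? (λ i → (B i BoolP.≟ true) ×-dec (f i FinP.≟ a))
  ... | yes p = p
  ... | no ¬p = contradiction (a , λ i Bi fi≡a → ¬p (i , Bi , fi≡a)) none
  member : Fin (suc d) → Fin _
  member a = proj₁ (preimage a)
  member∈B : ∀ a → B (member a) ≡ true
  member∈B a = proj₁ (proj₂ (preimage a))
  -- so the d+1 colours inject into the at most d members of B
  index : Fin (suc d) → Fin (count B)
  index a = embed B (member a) (member∈B a)
  no-collision : ¬ (Σ (Fin (suc d)) λ a → Σ (Fin (suc d)) λ b → a Fin.< b × index a ≡ index b)
  no-collision (a , b , a<b , eq) = FinP.<-irrefl a≡b a<b
    where
    a≡b : a ≡ b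
    a≡b = trans (sym (proj₂ (proj₂ (preimage a))))
                (trans (cong f (embed-injective B (member∈B a) (member∈B b) eq)) (proj₂ (proj₂ (preimage b))))

isEdge⇒isEdgeᵇ : ∀ G {i j} → IsEdge G i j → isEdgeᵇ G i j ≡ true
isEdge⇒isEdgeᵇ G (i<j , ij∈G) rewrite <⇒<ᵇ≡true i<j | ij∈G = refl

leftDeg : (G : OrderedGraph) → Fin (N G) → ℕ
leftDeg G v = count (λ u → isEdgeᵇ G u v)

-- every edge is counted once, at its right end
edgeCount≡∑leftDeg : ∀ G → edgeCount G ≡ sum (leftDeg G)
edgeCount≡∑leftDeg G = begin
  edgeCount G                                      ≡⟨ listSum-allFin (N G) _ ⟩
  sum (λ u → listSum (map (edge u) (allFinL (N G)))) ≡⟨ sum-cong-≗ (λ u → listSum-allFin (N G) (edge u)) ⟩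
  sum (λ u → sum (edge u))                         ≡⟨ ∑-comm edge ⟩
  sum (leftDeg G)                                  ∎
  where
  open ≡-Reasoning
  edge : Fin (N G) → Fin (N G) → ℕ
  edge u v = ind (isEdgeᵇ G u v)

-- Greedy colouring: if every left degree is at most d, then colouring the
-- vertices from left to right, each avoiding the colours of its left
-- neighbours, gives a proper colouring with d + 1 colours.
module Greedy (G : OrderedGraph) {d : ℕ} (sparse : ∀ v → leftDeg G v ≤ d) where

  ProperBelow : ℕ → (Fin (N G) → Fin (suc d)) → Set
  ProperBelow k f = ∀ i j → toℕ j < k → IsEdge G i j → f i ≢ f j

  greedy : ∀ k → k ≤ N G → Σ (Fin (N G) → Fin (suc d)) (ProperBelow k)
  greedy zero    _   = (λ _ → fzero) , λ _ _ ()
  greedy (suc k) k<N with greedy k (<⇒≤ k<N)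
  ... | f , proper = f′ , proper′
    where
    w : Fin (N G)
    w = fromℕ< k<N
    toℕ-w : toℕ w ≡ k
    toℕ-w = FinP.toℕ-fromℕ< k<N
    free : Σ (Fin (suc d)) λ a → ∀ u → isEdgeᵇ G u w ≡ true → f u ≢ a
    free = freeColour (λ u → isEdgeᵇ G u w) (sparse w) f
    f′ : Fin (N G) → Fin (suc d)
    f′ = updateAt f w (λ _ → proj₁ free)
    unchanged : ∀ x → toℕ x < k → f′ x ≡ f x
    unchanged x x<k = updateAt-minimal x w f (λ x≡w → <⇒≢ x<k (trans (cong toℕ x≡w) toℕ-w))
    proper′ : ProperBelow (suc k) f′
    proper′ i j (s≤s j≤k) ij with m≤n⇒m<n∨m≡n j≤k
    ... | inj₁ j<k = subst₂ _≢_ (sym (unchanged i (<-trans (proj₁ ij) j<k))) (sym (unchanged j j<k))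
                            (proper i j j<k ij)
    ... | inj₂ j≡k = subst₂ _≢_ (sym (unchanged i (subst (toℕ i <_) j≡k (proj₁ ij)))) (sym f′j≡a)
                            (proj₂ free i (subst (λ x → isEdgeᵇ G i x ≡ true) j≡w (isEdge⇒isEdgeᵇ G ij)))
      where
      j≡w : j ≡ w
      j≡w = FinP.toℕ-injective (trans j≡k (sym toℕ-w))
      f′j≡a : f′ j ≡ proj₁ free
      f′j≡a rewrite j≡w = updateAt-updates w f

  colouring : Colorable G (suc d)
  colouring with greedy (N G) ≤-refl
  ... | f , proper = f , λ i j → proper i j (FinP.toℕ<n j)

-- the subgraph of G induced on S (the vertices outside S become isolated)
induced : (G : OrderedGraph) → (Fin (N G) → Bool) → OrderedGraph
induced G S = mkOG (N G) (λ i j → (S i ∧ S j) ∧ adj G i j)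

complement : ∀ {n} → (Fin n → Bool) → Fin n → Bool
complement S x = not (S x)

_∖_ : ∀ {n} → (Fin n → Bool) → Fin n → Fin n → Bool
S ∖ v = updateAt S v (λ _ → false)

∖-⊆ : ∀ {n} (S : Fin n → Bool) v x → (S ∖ v) x ≡ true → S x ≡ true
∖-⊆ S v x with x FinP.≟ v
... | yes refl = λ removed → contradiction (trans (sym (updateAt-updates v S)) removed) (λ ())
... | no x≢v   = subst (_≡ true) (updateAt-minimal x v S x≢v)

leftDeg-induced-mono : ∀ G {S S′ : Fin (N G) → Bool} → (∀ x → S′ x ≡ true → S x ≡ true) →
                       ∀ v → leftDeg (induced G S′) v ≤ leftDeg (induced G S) v
leftDeg-induced-mono G S′⊆S v =
  ∑-mono-≤ (λ u → ind-mono (∧-mono {a = toℕ u <ᵇ toℕ v} (λ u<v → u<v)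
                               (∧-mono {b = adj G u v} (∧-mono (S′⊆S u) (S′⊆S v)) (λ uv → uv))))

leftDeg-outside : ∀ G {S : Fin (N G) → Bool} {v} → S v ≡ false → leftDeg (induced G S) v ≡ 0
leftDeg-outside G {S} {v} v∉S = trans (sum-cong-≗ no-edge) (sum-replicate-zero (N G))
  where
  no-edge : ∀ u → ind (isEdgeᵇ (induced G S) u v) ≡ 0
  no-edge u rewrite v∉S | ∧-zeroʳ (S u) | ∧-zeroʳ (toℕ u <ᵇ toℕ v) = refl

edgeCount-delete : ∀ G (S : Fin (N G) → Bool) v →
                   edgeCount (induced G (S ∖ v)) + leftDeg (induced G S) v ≤ edgeCount (induced G S)
edgeCount-delete G S v = begin
  edgeCount (induced G (S ∖ v)) + leftDeg (induced G S) v
    ≡⟨ cong (_+ leftDeg (induced G S) v) (edgeCount≡∑leftDeg (induced G (S ∖ v))) ⟩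
  sum (leftDeg (induced G (S ∖ v))) + leftDeg (induced G S) v
    ≤⟨ ∑-exchange v (λ x _ → leftDeg-induced-mono G (∖-⊆ S v) x) ⟩
  sum (leftDeg (induced G S)) + leftDeg (induced G (S ∖ v)) v
    ≡⟨ cong₂ _+_ (sym (edgeCount≡∑leftDeg (induced G S))) (leftDeg-outside G {S ∖ v} {v} (updateAt-updates v S)) ⟩
  edgeCount (induced G S) + 0
    ≡⟨ +-identityʳ _ ⟩
  edgeCount (induced G S) ∎
  where open ≤-Reasoning

count-delete : ∀ {n} (S : Fin n → Bool) v → count (complement (S ∖ v)) ≤ count (complement S) + 1
count-delete S v = begin
  count (complement (S ∖ v))                         ≤⟨ m≤m+n _ _ ⟩
  count (complement (S ∖ v)) + ind (not (S v))       ≤⟨ ∑-exchange v same-off-v ⟩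
  count (complement S) + ind (not ((S ∖ v) v))       ≤⟨ +-monoʳ-≤ _ (ind≤1 _) ⟩
  count (complement S) + 1                           ∎
  where
  open ≤-Reasoning
  same-off-v : ∀ x → x ≢ v → ind (not ((S ∖ v) x)) ≤ ind (not (S x))
  same-off-v x x≢v = ≤-reflexive (cong (ind ∘ not) (updateAt-minimal x v S x≢v))

Extensional : ∀ {m k} → ((Fin m → Fin k) → Set) → Set
Extensional P = ∀ {f g} → (∀ x → f x ≡ g x) → P f → P g

any-function? : ∀ m {k} (P : (Fin m → Fin k) → Set) → Extensional P → (∀ f → Dec (P f)) →
                Dec (Σ (Fin m → Fin k) P)
any-function? zero {k} P ext P? = map′ (empty ,_) (λ (f , p) → ext (λ ()) p) (P? empty)
  where
  empty : Fin 0 → Fin k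
  empty ()
any-function? (suc m) P ext P? =
  map′ (λ (a , g , p) → (a ∷ g) , p) (λ (f , p) → f fzero , (f ∘ fsuc) , ext head∷tail p)
       (FinP.any? λ a → any-function? m (λ g → P (a ∷ g)) (λ g≗h → ext (∷-congʳ a g≗h)) (λ g → P? (a ∷ g)))
  where
  head∷tail : ∀ {f : Fin (suc m) → Fin _} x → f x ≡ (f fzero ∷ (f ∘ fsuc)) x
  head∷tail fzero    = refl
  head∷tail (fsuc x) = refl
  ∷-congʳ : ∀ a {g h : Fin m → Fin _} → (∀ x → g x ≡ h x) → ∀ x → (a ∷ g) x ≡ (a ∷ h) x
  ∷-congʳ a g≗h fzero    = refl
  ∷-congʳ a g≗h (fsuc x) = g≗h x

isEdge? : ∀ G i j → Dec (IsEdge G i j)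
isEdge? G i j = (toℕ i <? toℕ j) ×-dec (adj G i j BoolP.≟ true)

isEdge-irrelevant : ∀ G {i j} (e e′ : IsEdge G i j) → e ≡ e′
isEdge-irrelevant G (i<j , ij) (i<j′ , ij′) =
  cong₂ _,_ (<-irrelevant i<j i<j′) (Decidable⇒UIP.≡-irrelevant BoolP._≟_ ij ij′)

ColouredEdge : ∀ {q} G → EdgeColoring q G → Fin q → Fin (N G) → Fin (N G) → Set
ColouredEdge G col c i j = Σ (IsEdge G i j) λ e → col i j e ≡ c

-- the colour of an edge does not depend on the proof that it is an edge
colouredEdge? : ∀ {q} G (col : EdgeColoring q G) c i j → Dec (ColouredEdge G col c i j)
colouredEdge? G col c i j with isEdge? G i j
... | no ¬e = no (¬e ∘ proj₁)
... | yes e with col i j e FinP.≟ c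
...   | yes eq = yes (e , eq)
...   | no  ne = no λ (e′ , eq) → ne (subst (λ x → col i j x ≡ c) (isEdge-irrelevant G e′ e) eq)

monoPath? : ∀ {q} m G (col : EdgeColoring q G) → Dec (MonoPath q m G col)
monoPath? m G col = any-function? m _ transport (λ v → FinP.any? λ c →
  FinP.all? λ k → FinP.all? λ k′ → (toℕ k′ ≟ toℕ k + 1) →-dec colouredEdge? G col c (v k) (v k′))
  where
  transport : Extensional _
  transport v≗w (c , path) = c , λ k k′ next → subst₂ (ColouredEdge G col c) (v≗w k) (v≗w k′) (path k k′ next)

colourable? : ∀ G k → Dec (Colorable G k)
colourable? G k = any-function? (N G) _ transport (λ f →
  FinP.all? λ i → FinP.all? λ j → isEdge? G i j →-dec ¬? (f i FinP.≟ f j))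
  where
  transport : Extensional _
  transport f≗g proper i j e gi≡gj = proper i j e (trans (f≗g i) (trans gi≡gj (sym (f≗g j))))

colourable-mono : ∀ G {k k′} → k ≤ k′ → Colorable G k → Colorable G k′
colourable-mono G k≤k′ (f , proper) =
  (λ x → Fin.inject≤ (f x) k≤k′) , λ i j e eq → proper i j e (FinP.inject≤-injective k≤k′ k≤k′ _ _ eq)

chromaticNumber-≤ : ∀ G k → Colorable G k → Σ ℕ λ χ → ChromaticNumber G χ × χ ≤ k
chromaticNumber-≤ G zero    col = 0 , (col , λ _ _ → z≤n) , z≤n
chromaticNumber-≤ G (suc k) col with colourable? G k
... | yes col-k = let (χ , chrom , χ≤k) = chromaticNumber-≤ G k col-k in χ , chrom , m≤n⇒m≤1+n χ≤k
... | no ¬col-k = suc k , (col , least) , ≤-refl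
  where
  least : ∀ m → Colorable G m → suc k ≤ m
  least m col-m = ≰⇒> (λ m≤k → ¬col-k (colourable-mono G m≤k col-m))

fewColours⇒¬Ramsey : ∀ {q m c} H k → Isχ q m c → Colorable H k → k < c → ¬ PathRamsey q m H
fewColours⇒¬Ramsey H k (_ , minimal) col k<c ramsey with chromaticNumber-≤ H k col
... | χ , chrom , χ≤k = <⇒≱ k<c (≤-trans (minimal χ (H , ramsey , chrom)) χ≤k)

smallComplete⇒¬Ramsey : ∀ {q m M M′} → IsN₂ q m M → M′ < M → ¬ PathRamsey q m (K M′)
smallComplete⇒¬Ramsey (_ , minimal) M′<M ramsey = <⇒≱ M′<M (minimal _ ramsey)

IsMonoPath : ∀ {q m} G → EdgeColoring q G → Fin q → (Fin m → Fin (N G)) → Set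
IsMonoPath G col c v = ∀ k k′ → toℕ k′ ≡ toℕ k + 1 → ColouredEdge G col c (v k) (v k′)

window : ∀ {ℓ m} (o : ℕ) → o + ℓ ≤ m → Fin ℓ → Fin m
window o fits k = fromℕ< (<-≤-trans (+-monoʳ-< o (FinP.toℕ<n k)) fits)

toℕ-window : ∀ {ℓ m} o (fits : o + ℓ ≤ m) k → toℕ (window o fits k) ≡ o + toℕ k
toℕ-window o fits k = FinP.toℕ-fromℕ< _

window-path : ∀ {q ℓ m} G (col : EdgeColoring q G) c {v : Fin m → Fin (N G)} o (fits : o + ℓ ≤ m) →
              IsMonoPath G col c v → IsMonoPath G col c (v ∘ window {ℓ} o fits)
window-path G col c o fits path k k′ next = path (window o fits k) (window o fits k′) (begin
  toℕ (window o fits k′)     ≡⟨ toℕ-window o fits k′ ⟩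
  o + toℕ k′                 ≡⟨ cong (o +_) next ⟩
  o + (toℕ k + 1)            ≡⟨ +-assoc o (toℕ k) 1 ⟨
  o + toℕ k + 1              ≡⟨ cong (_+ 1) (toℕ-window o fits k) ⟨
  toℕ (window o fits k) + 1  ∎)
  where open ≡-Reasoning

Absorbing : ∀ {m} → (Fin m → Bool) → Bool → Set
Absorbing s b = ∀ k k′ → toℕ k′ ≡ toℕ k + 1 → s k ≡ b → s k′ ≡ b

absorbing-upward : ∀ {m} (s : Fin m → Bool) b → Absorbing s b → ∀ {i j} → toℕ i ≤ toℕ j → s i ≡ b → s j ≡ b
absorbing-upward {suc m} s b absorbing {i} i≤j si≡b =
  <-weakInduction-startingFrom (λ j → s j ≡ b) si≡b step i≤j
  where
  step : ∀ j → s (Fin.inject₁ j) ≡ b → s (fsuc j) ≡ b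
  step j = absorbing (Fin.inject₁ j) (fsuc j)
                     (trans (cong suc (sym (FinP.toℕ-inject₁ j))) (+-comm 1 _))

prefix-fits : ∀ {x y m} → x + suc y ≤ m → 0 + suc x ≤ m
prefix-fits {x} {y} fits = ≤-trans (s≤s (m≤m+n x y)) (≤-trans (≤-reflexive (sym (+-suc x y))) fits)

absorbing-split : ∀ {m} (s : Fin m → Bool) b → Absorbing s b → ∀ x y (fits : x + suc y ≤ m) →
                  (∀ k → s (window x fits k) ≡ b) ⊎ (∀ k → s (window 0 (prefix-fits fits) k) ≢ b)
absorbing-split s b absorbing x y fits with s pivot BoolP.≟ b
  where
  pivot = window x fits fzero
... | yes pivot≡b = inj₁ λ k → absorbing-upward s b absorbing (after k) pivot≡b
  where
  after : ∀ k → toℕ (window x fits fzero) ≤ toℕ (window x fits k)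
  after k = subst₂ _≤_ (sym (toℕ-window x fits fzero)) (sym (toℕ-window x fits k)) (+-monoʳ-≤ x z≤n)
... | no pivot≢b = inj₂ λ k k≡b → pivot≢b (absorbing-upward s b absorbing (before k) k≡b)
  where
  before : ∀ k → toℕ (window 0 (prefix-fits fits) k) ≤ toℕ (window x fits fzero)
  before k = subst₂ _≤_ (sym (toℕ-window 0 (prefix-fits fits) k)) (sym (toℕ-window x fits fzero))
                     (≤-trans (≤-pred (FinP.toℕ<n k)) (≤-reflexive (sym (+-identityʳ x))))

module Gluing (G : OrderedGraph) (S : Fin (N G) → Bool) {q M : ℕ}
              (colR : EdgeColoring (suc (suc q)) (induced G S))
              (colK : EdgeColoring (suc (suc q)) (K M))
              (fits : count (complement S) ≤ M) where

  Colour : Set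
  Colour = Fin (suc (suc q))

  place : ∀ x → S x ≡ false → Fin M
  place x x∉S = Fin.inject≤ (embed (complement S) x (cong not x∉S)) fits

  place-strictMono : ∀ {x y} (x∉S : S x ≡ false) (y∉S : S y ≡ false) →
                     toℕ x < toℕ y → place x x∉S Fin.< place y y∉S
  place-strictMono x∉S y∉S x<y = subst₂ _<_ (sym (FinP.toℕ-inject≤ _ fits)) (sym (FinP.toℕ-inject≤ _ fits))
    (embed-strictMono (complement S) (cong not x∉S) (cong not y∉S) x<y)

  inside-edge : ∀ {x y} → S x ≡ true → S y ≡ true → IsEdge G x y → IsEdge (induced G S) x y
  inside-edge x∈S y∈S (x<y , xy) rewrite x∈S | y∈S = x<y , xy

  glueCases : ∀ x y → IsEdge G x y → ∀ bx by → S x ≡ bx → S y ≡ by → Colour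
  glueCases x y e true  true  x∈S y∈S = colR x y (inside-edge x∈S y∈S e)
  glueCases x y e false false x∉S y∉S = colK (place x x∉S) (place y y∉S) (place-strictMono x∉S y∉S (proj₁ e) , refl)
  glueCases x y e true  false _   _   = fsuc fzero
  glueCases x y e false true  _   _   = fzero

  glue : EdgeColoring (suc (suc q)) G
  glue x y e = glueCases x y e (S x) (S y) refl refl

  glue-cases : ∀ {x y} (e : IsEdge G x y) {bx by} (px : S x ≡ bx) (py : S y ≡ by) →
               glue x y e ≡ glueCases x y e bx by px py
  glue-cases e refl refl = refl

  module _ {x y : Fin (N G)} {c : Colour} where
    inside : (x∈S : S x ≡ true) (y∈S : S y ≡ true) → ColouredEdge G glue c x y → ColouredEdge (induced G S) colR c x y
    inside x∈S y∈S (e , glue≡c) = inside-edge x∈S y∈S e , trans (sym (glue-cases e x∈S y∈S)) glue≡c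

    outside : (x∉S : S x ≡ false) (y∉S : S y ≡ false) → ColouredEdge G glue c x y →
              ColouredEdge (K M) colK c (place x x∉S) (place y y∉S)
    outside x∉S y∉S (e , glue≡c) = (place-strictMono x∉S y∉S (proj₁ e) , refl) , trans (sym (glue-cases e x∉S y∉S)) glue≡c

    leaving : S x ≡ true → S y ≡ false → ColouredEdge G glue c x y → fsuc fzero ≡ c
    leaving x∈S y∉S (e , glue≡c) = trans (sym (glue-cases e x∈S y∉S)) glue≡c

    entering : S x ≡ false → S y ≡ true → ColouredEdge G glue c x y → fzero ≡ c
    entering x∉S y∈S (e , glue≡c) = trans (sym (glue-cases e x∉S y∈S)) glue≡c

  module _ {m} (v : Fin m → Fin (N G)) (c : Colour) (path : IsMonoPath G glue c v) where
    inside-path : ∀ {ℓ} o (fits : o + ℓ ≤ m) → (∀ k → S (v (window o fits k)) ≡ true) →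
                  MonoPath (suc (suc q)) ℓ (induced G S) colR
    inside-path o fits in-S = v ∘ window o fits , c , λ k k′ next →
      inside (in-S k) (in-S k′) (window-path G glue c o fits path k k′ next)

    outside-path : ∀ {ℓ} o (fits : o + ℓ ≤ m) → (∀ k → S (v (window o fits k)) ≡ false) →
                   MonoPath (suc (suc q)) ℓ (K M) colK
    outside-path o fits out = (λ k → place (v (window o fits k)) (out k)) , c , λ k k′ next →
      outside (out k) (out k′) (window-path G glue c o fits path k k′ next)

    -- a path of colour 0 never leaves S, since leaving edges have colour 1
    stays-inside : c ≡ fzero → Absorbing (S ∘ v) true
    stays-inside c≡0 k k′ next vk∈S with S (v k′) in vk′
    ... | true  = refl
    ... | false = contradiction (trans (leaving vk∈S vk′ (path k k′ next)) c≡0) (λ ())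

    -- a path of any other colour never enters S, since entering edges have colour 0
    stays-outside : c ≢ fzero → Absorbing (S ∘ v) false
    stays-outside c≢0 k k′ next vk∉S with S (v k′) in vk′
    ... | false = refl
    ... | true  = contradiction (sym (entering vk∉S vk′ (path k k′ next))) c≢0

  split-path : ∀ a₁ a₂ → MonoPath (suc (suc q)) (a₁ + suc a₂) G glue →
               MonoPath (suc (suc q)) (suc a₁) (induced G S) colR ⊎ MonoPath (suc (suc q)) (suc a₂) (K M) colK
  split-path a₁ a₂ (v , c , path) with c FinP.≟ fzero
  ... | yes c≡0 =
    ⊎-map (inside-path v c path a₂ fits′)
          (λ avoid → outside-path v c path 0 (prefix-fits fits′) (¬-not ∘ avoid))
          (absorbing-split (S ∘ v) true (stays-inside v c path c≡0) a₂ a₁ fits′)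
    where
    fits′ : a₂ + suc a₁ ≤ a₁ + suc a₂
    fits′ = ≤-reflexive (trans (+-suc a₂ a₁) (trans (cong suc (+-comm a₂ a₁)) (sym (+-suc a₁ a₂))))
  ... | no c≢0 = ⊎-swap
    (⊎-map (outside-path v c path a₁ ≤-refl)
           (λ avoid → inside-path v c path 0 (prefix-fits {a₁} {a₂} ≤-refl) (¬-not ∘ avoid))
           (absorbing-split (S ∘ v) false (stays-outside v c path c≢0) a₁ a₂ ≤-refl))

-- If G is (q, a₁ + 1 + a₂)-path Ramsey and G[S] is not (q, a₁ + 1)-path
-- Ramsey, then K_M is (q, a₂ + 1)-path Ramsey whenever M ≥ |complement of S|:
-- otherwise gluing bad colourings of both would give a bad colouring of G.
glue-Ramsey : ∀ {q M} a₁ a₂ G (S : Fin (N G) → Bool) → PathRamsey (suc (suc q)) (a₁ + suc a₂) G →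
              count (complement S) ≤ M → ¬ PathRamsey (suc (suc q)) (suc a₁) (induced G S) →
              PathRamsey (suc (suc q)) (suc a₂) (K M)
glue-Ramsey {M = M} a₁ a₂ G S ramsey fits ¬ramsey-S colK with monoPath? (suc a₂) (K M) colK
... | yes pathK = pathK
... | no ¬pathK = contradiction ramsey-S ¬ramsey-S
  where
  ramsey-S : PathRamsey _ (suc a₁) (induced G S)
  ramsey-S colR with Gluing.split-path G S colR colK fits a₁ a₂ (ramsey (Gluing.glue G S colR colK fits))
  ... | inj₁ pathR = pathR
  ... | inj₂ pathK = contradiction pathK ¬pathK

module Peeling {q a₁ a₂ d M′ : ℕ} (G : OrderedGraph)
               (ramsey : PathRamsey (suc (suc q)) (a₁ + suc a₂) G)
               (χ-is : Isχ (suc (suc q)) (suc a₁) (suc (suc d)))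
               (N₂-is : IsN₂ (suc (suc q)) (suc a₂) (suc M′)) where

  -- Every G[S] missing at most M′ vertices has a vertex of left degree at
  -- least d+1: otherwise the greedy colouring shows χ(G[S]) ≤ d+1, so G[S] is
  -- not (q+2, a₁+1)-path Ramsey, and gluing would make K_{M′} path Ramsey.
  dense-vertex : ∀ S → count (complement S) ≤ M′ → Σ (Fin (N G)) λ v → suc d ≤ leftDeg (induced G S) v
  dense-vertex S fits with FinP.all? (λ v → leftDeg (induced G S) v ≤? d)
  ... | no ¬sparse = map₂ ≰⇒> (FinP.¬∀⟶∃¬ _ _ (λ v → leftDeg (induced G S) v ≤? d) ¬sparse)
  ... | yes sparse = contradiction (glue-Ramsey a₁ a₂ G S ramsey fits ¬ramsey-S) (smallComplete⇒¬Ramsey N₂-is ≤-refl)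
    where
    ¬ramsey-S : ¬ PathRamsey (suc (suc q)) (suc a₁) (induced G S)
    ¬ramsey-S = fewColours⇒¬Ramsey (induced G S) (suc d) χ-is (Greedy.colouring (induced G S) sparse) ≤-refl

  peel : ∀ t S → count (complement S) + t ≤ suc M′ → t * suc d ≤ edgeCount (induced G S)
  peel zero    S _    = z≤n
  peel (suc t) S room with dense-vertex S (≤-pred (<-≤-trans (m<m+n (count (complement S)) z<s) room))
  ... | v , dense = begin
    suc d + t * suc d                                        ≤⟨ +-mono-≤ dense (peel t (S ∖ v) room′) ⟩
    leftDeg (induced G S) v + edgeCount (induced G (S ∖ v))  ≡⟨ +-comm (leftDeg (induced G S) v) _ ⟩
    edgeCount (induced G (S ∖ v)) + leftDeg (induced G S) v  ≤⟨ edgeCount-delete G S v ⟩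
    edgeCount (induced G S)                                  ∎
    where
    open ≤-Reasoning
    room′ : count (complement (S ∖ v)) + t ≤ suc M′
    room′ = ≤-trans (+-monoˡ-≤ t (count-delete S v)) (≤-trans (≤-reflexive (+-assoc _ 1 t)) room)

  edge-bound : suc M′ * suc d ≤ edgeCount G
  edge-bound = peel (suc M′) (λ _ → true) (≤-reflexive (cong (_+ suc M′) (sum-replicate-zero (N G))))

theorem12 : (n₁ n₂ q : ℕ) → 2 ≤ n₁ → 2 ≤ n₂ → 2 ≤ q →
    (s c M : ℕ) → IsS₂ q (n₁ + n₂ ∸ 1) s → Isχ q n₁ c → IsN₂ q n₂ M →
    (c ∸ 1) * M ≤ 2 * s
-- the hypotheses n₁, n₂, q ≥ 2
theorem12 zero     _        _             ()      _       _          _ _ _ _ _ _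
theorem12 (suc _)  zero     _             _       ()      _          _ _ _ _ _ _
theorem12 (suc _)  (suc _)  zero          _       _       ()         _ _ _ _ _ _
theorem12 (suc _)  (suc _)  (suc zero)    _       _       (s≤s ())   _ _ _ _ _ _
-- if χ(q,n₁) ≤ 1 or N₂(q,n₂) = 0 the left-hand side vanishes
theorem12 (suc _)  (suc _)  (suc (suc _)) _ _ _ _ zero          _    _ _ _ = z≤n
theorem12 (suc _)  (suc _)  (suc (suc _)) _ _ _ _ (suc zero)    _    _ _ _ = z≤n
theorem12 (suc _)  (suc _)  (suc (suc _)) _ _ _ _ (suc (suc d)) zero _ _ _ =
  ≤-trans (≤-reflexive (*-zeroʳ (suc d))) z≤n
theorem12 (suc a₁) (suc a₂) (suc (suc q)) _ _ _ s (suc (suc d)) (suc M′) ((G , ramsey , edges≡s) , _) χ-is N₂-is =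
  begin
    suc d * suc M′   ≡⟨ *-comm (suc d) (suc M′) ⟩
    suc M′ * suc d   ≤⟨ Peeling.edge-bound G ramsey χ-is N₂-is ⟩
    edgeCount G      ≡⟨ edges≡s ⟩
    s                ≤⟨ m≤m+n s (s + 0) ⟩
    2 * s            ∎
  where open ≤-Reasoning
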